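{- Let $M=(\mathbb{F}_2^n,m)$ be a Boolean multiset with nonempty support $S_M$. Then $M$ is fully balanced, i.e. $B(M)\cup C(M)=\mathbb{F}_2^n$, if and only if $S_M$ is an affine subspace of $\mathbb{F}_2^n$ and $m$ is constant on $S_M$.
   Context: For $\mathbf{x},\mathbf{y}\in\mathbb{F}_2^n$ the pairing is $\mathbf{x}\cdot\mathbf{y}=\sum_{i=1}^n x_iy_i\in\mathbb{F}_2$. A Boolean multiset is a pair $M=(\mathbb{F}_2^n,m)$ with $m:\mathbb{F}_2^n\to\mathbb{Z}_{\geq 0}$; its support is $S_M=\{\mathbf{x}\mid m(\mathbf{x})>0\}$. A vector $\mathbf{y}\in\mathbb{F}_2^n$ balances $M$ if $\sum_{\mathbf{x}\in S_M}m(\mathbf{x})(-1)^{\mathbf{x}\cdot\mathbf{y}}=0$, and fixes $M$ if $\left|\sum_{\mathbf{x}\in S_M}m(\mathbf{x})(-1)^{\mathbf{x}\cdot\mathbf{y}}\right|=\sum_{\mathbf{x}\in S_M}m(\mathbf{x})$. $B(M)$ is the set of vectors balancing $M$ and $C(M)$ the set of vectors fixing $M$. Affine subspaces are nonempty by convention. -}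

module Defs where

open import Data.Bool using (Bool; true; false; _xor_; _∧_; if_then_else_)
open import Data.Nat using (ℕ; _<_)
open import Data.Integer using (ℤ; +_; -_; ∣_∣) renaming (_+_ to _+ℤ_; _*_ to _*ℤ_)
open import Data.List using (List; []; _∷_; map; _++_; foldr)
open import Data.Vec using (Vec; []; _∷_; zipWith; replicate)
open import Data.Product using (Σ; ∃; _×_; _,_)
open import Data.Sum using (_⊎_)
open import Relation.Binary.PropositionalEquality using (_≡_)
import Data.Nat as ℕ

-- 𝔽₂ is modelled by Bool (xor = addition, ∧ = multiplication); 𝔽₂ⁿ by Vec Bool n.

allVecs : (n : ℕ) → List (Vec Bool n)
allVecs ℕ.zero = [] ∷ []
allVecs (ℕ.suc n) = map (false ∷_) (allVecs n) ++ map (true ∷_) (allVecs n)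

_⊕_ : {n : ℕ} → Vec Bool n → Vec Bool n → Vec Bool n
_⊕_ = zipWith _xor_

𝟎 : {n : ℕ} → Vec Bool n
𝟎 = replicate _ false

_·_ : {n : ℕ} → Vec Bool n → Vec Bool n → Bool
[] · [] = false
(a ∷ x) · (b ∷ y) = (a ∧ b) xor (x · y)

sgn : Bool → ℤ
sgn false = + 1
sgn true = - (+ 1)

-- A Boolean multiset M = (𝔽₂ⁿ, m) is given by its multiplicity function m.
Multiset : ℕ → Set
Multiset n = Vec Bool n → ℕ

sumℤ : List ℤ → ℤ
sumℤ = foldr _+ℤ_ (+ 0)

sumℕ : List ℕ → ℕ
sumℕ = foldr ℕ._+_ 0

Support : {n : ℕ} → Multiset n → Vec Bool n → Set
Support m x = 0 < m x

-- Σ_{x ∈ S_M} m(x) (-1)^{x·y}  (terms outside S_M have m(x) = 0, so summing over all of 𝔽₂ⁿ is the same)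
charSum : {n : ℕ} → Multiset n → Vec Bool n → ℤ
charSum {n} m y = sumℤ (map (λ x → (+ m x) *ℤ sgn (x · y)) (allVecs n))

total : {n : ℕ} → Multiset n → ℕ
total {n} m = sumℕ (map m (allVecs n))

Balances : {n : ℕ} → Multiset n → Vec Bool n → Set
Balances m y = charSum m y ≡ + 0

Fixes : {n : ℕ} → Multiset n → Vec Bool n → Set
Fixes m y = ∣ charSum m y ∣ ≡ total m

FullyBalanced : {n : ℕ} → Multiset n → Set
FullyBalanced m = ∀ y → Balances m y ⊎ Fixes m y

-- linear subspace of 𝔽₂ⁿ (scalars are only 0,1, so closure under + and containing 0 suffices)
IsLinearSubspace : {n : ℕ} → (Vec Bool n → Set) → Set
IsLinearSubspace V = V 𝟎 × (∀ x y → V x → V y → V (x ⊕ y))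

-- affine subspace: a translate a + V of a linear subspace V (hence nonempty)
IsAffineSubspace : {n : ℕ} → (Vec Bool n → Set) → Set₁
IsAffineSubspace {n} S =
  Σ (Vec Bool n) λ a → Σ (Vec Bool n → Set) λ V →
    IsLinearSubspace V × (∀ x → (S x → V (x ⊕ a)) × (V (x ⊕ a) → S x))

ConstantOn : {n : ℕ} → Multiset n → (Vec Bool n → Set) → Set
ConstantOn m S = ∀ x y → S x → S y → m x ≡ m y

-- If every y balances or fixes M, the transform ŝ(y) = Σ m(x)(-1)^{x·y} vanishes off the set C
-- of fixing vectors, and on C it is ±|M| with the sign of x₀·y for any x₀ in the support.
-- Fourier inversion then gives 2ⁿ m(x) = |M|·|C| for every x in the coset x₀ + C^⊥, which
-- contains the support; so the support is that coset and m is constant on it.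
-- Conversely, if the support is a + V with m constant, then either x·y is constant on the
-- support (y fixes), or some v ∈ V has v·y = 1, and translation by v negates every term of
-- ŝ(y) (y balances).

module Submission where

open import Defs
open import Data.Nat using (ℕ)
open import Data.Vec using (Vec)
open import Data.Bool using (Bool)
open import Data.Product using (∃; _×_)
open import Function.Bundles using (_⇔_; mk⇔)

open import Algebra.Bundles using (CommutativeSemigroup; CommutativeRing)
open import Algebra.Core using (Op₂)
open import Algebra.Structures using (IsCommutativeSemigroup; IsMonoid)
import Algebra.Properties.CommutativeSemigroup as CommutativeSemigroupProperties
open import Data.Bool using (true; false; not; _xor_; _∧_; if_then_else_; _≟_)
open import Data.Bool.Properties
  using (xor-assoc; xor-comm; xor-identityʳ; xor-same; ∧-distribʳ-xor; ¬-not; not-involutive; xor-∧-commutativeRing)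
open import Data.Integer using (ℤ; +_; -_; ∣_∣; _+_; _*_; _-_; 0ℤ; -1ℤ; +[1+_]; -[1+_])
import Data.Integer.Properties as ℤₚ
open import Data.Integer.Tactic.RingSolver using (solve-∀)
open import Data.List using ([]; _∷_; map; _++_; foldr)
open import Data.List.Properties using (map-++; map-∘)
import Data.Nat as ℕ
open import Data.Nat using (zero; suc; _<_; _≤_; _^_; _<?_; z≤n; s≤s)
import Data.Nat.Properties as ℕₚ
open import Data.Product using (_,_; proj₁; proj₂; uncurry)
open import Data.Sum using (_⊎_; inj₁; inj₂; [_,_])
open import Data.Vec using ([]; _∷_)
open import Data.Vec.Properties using (zipWith-assoc; zipWith-comm; zipWith-identityʳ)
open import Function using (_∘_; const)
open import Level using (0ℓ)
open import Relation.Binary.PropositionalEquality hiding ([_])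
open import Relation.Nullary using (Dec; yes; no; ¬_; contradiction)
open import Relation.Nullary.Decidable using (map′; _⊎-dec_; _×-dec_)
open import Relation.Unary using (Decidable)
open ≡-Reasoning

⊕-assoc : ∀ {n} (x y z : Vec Bool n) → (x ⊕ y) ⊕ z ≡ x ⊕ (y ⊕ z)
⊕-assoc = zipWith-assoc xor-assoc

⊕-comm : ∀ {n} (x y : Vec Bool n) → x ⊕ y ≡ y ⊕ x
⊕-comm = zipWith-comm xor-comm

⊕-identityʳ : ∀ {n} (x : Vec Bool n) → x ⊕ 𝟎 ≡ x
⊕-identityʳ = zipWith-identityʳ xor-identityʳ

⊕-self : ∀ {n} (x : Vec Bool n) → x ⊕ x ≡ 𝟎
⊕-self []      = refl
⊕-self (a ∷ x) = cong₂ _∷_ (xor-same a) (⊕-self x)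

⊕-cancelʳ : ∀ {n} (x v : Vec Bool n) → (x ⊕ v) ⊕ v ≡ x
⊕-cancelʳ x v = begin
  (x ⊕ v) ⊕ v ≡⟨ ⊕-assoc x v v ⟩
  x ⊕ (v ⊕ v) ≡⟨ cong (x ⊕_) (⊕-self v) ⟩
  x ⊕ 𝟎       ≡⟨ ⊕-identityʳ x ⟩
  x           ∎

⊕-swapʳ : ∀ {n} (x y z : Vec Bool n) → (x ⊕ y) ⊕ z ≡ (x ⊕ z) ⊕ y
⊕-swapʳ x y z = begin
  (x ⊕ y) ⊕ z ≡⟨ ⊕-assoc x y z ⟩
  x ⊕ (y ⊕ z) ≡⟨ cong (x ⊕_) (⊕-comm y z) ⟩
  x ⊕ (z ⊕ y) ≡⟨ ⊕-assoc x z y ⟨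
  (x ⊕ z) ⊕ y ∎

xor≡false⇒≡ : ∀ {a b} → a xor b ≡ false → a ≡ b
xor≡false⇒≡ {false} {false} _ = refl
xor≡false⇒≡ {true}  {true}  _ = refl

·-zeroˡ : ∀ {n} (y : Vec Bool n) → 𝟎 · y ≡ false
·-zeroˡ []      = refl
·-zeroˡ (_ ∷ y) = ·-zeroˡ y

·-zeroʳ : ∀ {n} (x : Vec Bool n) → x · 𝟎 ≡ false
·-zeroʳ []          = refl
·-zeroʳ (false ∷ x) = ·-zeroʳ x
·-zeroʳ (true ∷ x)  = ·-zeroʳ x

·-distribʳ-⊕ : ∀ {n} (x z y : Vec Bool n) → (x ⊕ z) · y ≡ (x · y) xor (z · y)
·-distribʳ-⊕ []      []      []      = refl
·-distribʳ-⊕ (a ∷ x) (c ∷ z) (b ∷ y) = begin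
  ((a xor c) ∧ b) xor ((x ⊕ z) · y)
    ≡⟨ cong₂ _xor_ (∧-distribʳ-xor b a c) (·-distribʳ-⊕ x z y) ⟩
  ((a ∧ b) xor (c ∧ b)) xor ((x · y) xor (z · y))
    ≡⟨ interchange (a ∧ b) (c ∧ b) (x · y) (z · y) ⟩
  ((a ∧ b) xor (x · y)) xor ((c ∧ b) xor (z · y)) ∎
  where
  open CommutativeSemigroupProperties
    (CommutativeRing.+-commutativeSemigroup xor-∧-commutativeRing) using (interchange)

sgn-xor : ∀ a b → sgn (a xor b) ≡ sgn a * sgn b
sgn-xor false b     = sym (ℤₚ.*-identityˡ (sgn b))
sgn-xor true  false = refl
sgn-xor true  true  = refl

sgn-·-⊕ : ∀ {n} (x z y : Vec Bool n) → sgn ((x ⊕ z) · y) ≡ sgn (x · y) * sgn (z · y)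
sgn-·-⊕ x z y = trans (cong sgn (·-distribʳ-⊕ x z y)) (sgn-xor (x · y) (z · y))

Annihilator : ∀ {n} → (Vec Bool n → Set) → Vec Bool n → Set
Annihilator P w = ∀ y → P y → w · y ≡ false

annihilator-isLinearSubspace : ∀ {n} (P : Vec Bool n → Set) → IsLinearSubspace (Annihilator P)
annihilator-isLinearSubspace P =
  (λ y _ → ·-zeroˡ y) ,
  λ w w′ w⊥P w′⊥P y Py → trans (·-distribʳ-⊕ w w′ y) (cong₂ _xor_ (w⊥P y Py) (w′⊥P y Py))

affine-translate : ∀ {n} {S V : Vec Bool n → Set} {a v x : Vec Bool n} →
  IsLinearSubspace V → (∀ x → (S x → V (x ⊕ a)) × (V (x ⊕ a) → S x)) →
  V v → S x → S (x ⊕ v)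
affine-translate {V = V} {a} {v} {x} (_ , V-closed) coset v∈V x∈S =
  proj₂ (coset (x ⊕ v)) (subst V (⊕-swapʳ x a v) (V-closed _ _ (proj₁ (coset x) x∈S) v∈V))

any? : ∀ {n} {P : Vec Bool n → Set} → Decidable P → Dec (∃ P)
any? {zero}  P? = map′ ([] ,_) (λ { ([] , p) → p }) (P? [])
any? {suc n} P? = map′ from to (any? (P? ∘ (false ∷_)) ⊎-dec any? (P? ∘ (true ∷_)))
  where
  from = [ (λ { (x , p) → false ∷ x , p }) , (λ { (x , p) → true ∷ x , p }) ]
  to = λ { (false ∷ x , p) → inj₁ (x , p) ; (true ∷ x , p) → inj₂ (x , p) }

-- Sums over 𝔽₂ⁿ

sumWith : ∀ {A : Set} → Op₂ A → ∀ {n} → (Vec Bool n → A) → A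
sumWith _∙_ {zero}  f = f []
sumWith _∙_ {suc n} f = sumWith _∙_ (f ∘ (false ∷_)) ∙ sumWith _∙_ (f ∘ (true ∷_))

∑ℤ : ∀ {n} → (Vec Bool n → ℤ) → ℤ
∑ℤ = sumWith _+_

∑ℕ : ∀ {n} → (Vec Bool n → ℕ) → ℕ
∑ℕ = sumWith ℕ._+_

module _ {A : Set} {_∙_ : Op₂ A} where

  sumWith-cong : ∀ {n} {f g : Vec Bool n → A} → (∀ x → f x ≡ g x) → sumWith _∙_ f ≡ sumWith _∙_ g
  sumWith-cong {zero}  f≗g = f≗g []
  sumWith-cong {suc n} f≗g =
    cong₂ _∙_ (sumWith-cong (λ x → f≗g (false ∷ x))) (sumWith-cong (λ x → f≗g (true ∷ x)))

  sumWith-hom : ∀ {B : Set} {_◦_ : Op₂ B} (h : A → B) → (∀ a b → h (a ∙ b) ≡ h a ◦ h b) →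
                ∀ {n} (f : Vec Bool n → A) → h (sumWith _∙_ f) ≡ sumWith _◦_ (h ∘ f)
  sumWith-hom             h h-∙ {zero}  f = refl
  sumWith-hom {_◦_ = _◦_} h h-∙ {suc n} f =
    trans (h-∙ _ _) (cong₂ _◦_ (sumWith-hom {_◦_ = _◦_} h h-∙ (f ∘ (false ∷_)))
                               (sumWith-hom {_◦_ = _◦_} h h-∙ (f ∘ (true ∷_))))

module _ {A : Set} {_∙_ : Op₂ A} (isCommutativeSemigroup : IsCommutativeSemigroup _≡_ _∙_) where

  private
    commutativeSemigroup : CommutativeSemigroup 0ℓ 0ℓ
    commutativeSemigroup = record { isCommutativeSemigroup = isCommutativeSemigroup }

  open IsCommutativeSemigroup isCommutativeSemigroup using (comm)
  open CommutativeSemigroupProperties commutativeSemigroup using (interchange)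

  sumWith-distrib : ∀ {n} (f g : Vec Bool n → A) →
                    sumWith _∙_ (λ x → f x ∙ g x) ≡ sumWith _∙_ f ∙ sumWith _∙_ g
  sumWith-distrib {zero}  f g = refl
  sumWith-distrib {suc n} f g =
    trans (cong₂ _∙_ (sumWith-distrib (f ∘ (false ∷_)) (g ∘ (false ∷_)))
                     (sumWith-distrib (f ∘ (true ∷_)) (g ∘ (true ∷_))))
          (interchange _ _ _ _)

  sumWith-swap : ∀ {k n} (h : Vec Bool k → Vec Bool n → A) →
                 sumWith _∙_ (λ y → sumWith _∙_ (h y)) ≡ sumWith _∙_ (λ z → sumWith _∙_ (λ y → h y z))
  sumWith-swap {zero}  h = refl
  sumWith-swap {suc k} h =
    trans (cong₂ _∙_ (sumWith-swap (h ∘ (false ∷_))) (sumWith-swap (h ∘ (true ∷_))))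
          (sym (sumWith-distrib (λ z → sumWith _∙_ (λ y → h (false ∷ y) z))
                                (λ z → sumWith _∙_ (λ y → h (true ∷ y) z))))

  sumWith-translate : ∀ {n} (f : Vec Bool n → A) (v : Vec Bool n) →
                      sumWith _∙_ (λ x → f (x ⊕ v)) ≡ sumWith _∙_ f
  sumWith-translate f []          = refl
  sumWith-translate f (false ∷ v) =
    cong₂ _∙_ (sumWith-translate (f ∘ (false ∷_)) v) (sumWith-translate (f ∘ (true ∷_)) v)
  sumWith-translate f (true ∷ v)  =
    trans (cong₂ _∙_ (sumWith-translate (f ∘ (true ∷_)) v) (sumWith-translate (f ∘ (false ∷_)) v))
          (comm _ _)

module _ {A : Set} {_∙_ : Op₂ A} {ε : A} (isMonoid : IsMonoid _≡_ _∙_ ε) where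

  open IsMonoid isMonoid using (assoc; identityˡ; identityʳ)

  foldr-∙-++ : ∀ xs ys → foldr _∙_ ε (xs ++ ys) ≡ foldr _∙_ ε xs ∙ foldr _∙_ ε ys
  foldr-∙-++ []       ys = sym (identityˡ _)
  foldr-∙-++ (x ∷ xs) ys = trans (cong (x ∙_) (foldr-∙-++ xs ys)) (sym (assoc x _ _))

  foldr-allVecs : ∀ n (f : Vec Bool n → A) → foldr _∙_ ε (map f (allVecs n)) ≡ sumWith _∙_ f
  foldr-allVecs zero    f = identityʳ (f [])
  foldr-allVecs (suc n) f = begin
    foldr _∙_ ε (map f (map (false ∷_) vs ++ map (true ∷_) vs))
      ≡⟨ cong (foldr _∙_ ε) (map-++ f (map (false ∷_) vs) _) ⟩
    foldr _∙_ ε (map f (map (false ∷_) vs) ++ map f (map (true ∷_) vs))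
      ≡⟨ foldr-∙-++ (map f (map (false ∷_) vs)) _ ⟩
    foldr _∙_ ε (map f (map (false ∷_) vs)) ∙ foldr _∙_ ε (map f (map (true ∷_) vs))
      ≡⟨ cong₂ (λ us ws → foldr _∙_ ε us ∙ foldr _∙_ ε ws) (map-∘ vs) (map-∘ vs) ⟨
    foldr _∙_ ε (map (f ∘ (false ∷_)) vs) ∙ foldr _∙_ ε (map (f ∘ (true ∷_)) vs)
      ≡⟨ cong₂ _∙_ (foldr-allVecs n _) (foldr-allVecs n _) ⟩
    sumWith _∙_ f ∎
    where vs = allVecs n

∑ℤ-*ˡ : ∀ {n} (c : ℤ) (f : Vec Bool n → ℤ) → ∑ℤ (λ x → c * f x) ≡ c * ∑ℤ f
∑ℤ-*ˡ c f = sym (sumWith-hom (c *_) (ℤₚ.*-distribˡ-+ c) f)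

∑ℤ-*ʳ : ∀ {n} (f : Vec Bool n → ℤ) (c : ℤ) → ∑ℤ (λ x → f x * c) ≡ ∑ℤ f * c
∑ℤ-*ʳ f c = sym (sumWith-hom (_* c) (λ a b → ℤₚ.*-distribʳ-+ c a b) f)

∑ℤ-neg : ∀ {n} (f : Vec Bool n → ℤ) → ∑ℤ (λ x → - f x) ≡ - ∑ℤ f
∑ℤ-neg f = sym (sumWith-hom -_ ℤₚ.neg-distrib-+ f)

∑ℤ-pos : ∀ {n} (f : Vec Bool n → ℕ) → ∑ℤ (λ x → + f x) ≡ + ∑ℕ f
∑ℤ-pos f = sym (sumWith-hom +_ ℤₚ.pos-+ f)

∑ℤ-*-zero : ∀ {n} (f : Vec Bool n → ℤ) → ∑ℤ (λ x → f x * 0ℤ) ≡ 0ℤ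
∑ℤ-*-zero f = trans (∑ℤ-*ʳ f 0ℤ) (ℤₚ.*-zeroʳ (∑ℤ f))

term≤∑ℕ : ∀ {n} (f : Vec Bool n → ℕ) x → f x ≤ ∑ℕ f
term≤∑ℕ f []          = ℕₚ.≤-refl
term≤∑ℕ f (false ∷ x) = ℕₚ.≤-trans (term≤∑ℕ (f ∘ (false ∷_)) x) (ℕₚ.m≤m+n _ _)
term≤∑ℕ f (true ∷ x)  = ℕₚ.≤-trans (term≤∑ℕ (f ∘ (true ∷_)) x) (ℕₚ.m≤n+m _ _)

-- Fourier analysis on 𝔽₂ⁿ

fourier : ∀ {n} → (Vec Bool n → ℤ) → Vec Bool n → ℤ
fourier f y = ∑ℤ (λ x → f x * sgn (x · y))

δ𝟎 : ∀ {n} → Vec Bool n → ℤ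
δ𝟎 []          = + 1
δ𝟎 (false ∷ w) = δ𝟎 w
δ𝟎 (true ∷ w)  = 0ℤ

sgn-not : ∀ b → sgn (not b) ≡ - sgn b
sgn-not false = refl
sgn-not true  = refl

∑-sgn : ∀ {n} (w : Vec Bool n) → ∑ℤ (λ y → sgn (w · y)) ≡ + (2 ^ n) * δ𝟎 w
∑-sgn []                  = refl
∑-sgn {suc n} (false ∷ w) = begin
  ∑ℤ (λ y → sgn (w · y)) + ∑ℤ (λ y → sgn (w · y)) ≡⟨ cong₂ _+_ (∑-sgn w) (∑-sgn w) ⟩
  + (2 ^ n) * δ𝟎 w + + (2 ^ n) * δ𝟎 w            ≡⟨ double (+ (2 ^ n)) (δ𝟎 w) ⟩
  (+ 2 * + (2 ^ n)) * δ𝟎 w                        ≡⟨ cong (_* δ𝟎 w) (ℤₚ.pos-* 2 (2 ^ n)) ⟨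
  + (2 ^ suc n) * δ𝟎 w                            ∎
  where
  double : ∀ (a d : ℤ) → a * d + a * d ≡ (+ 2 * a) * d
  double = solve-∀
∑-sgn {suc n} (true ∷ w)  = begin
  ∑ℤ (λ y → sgn (w · y)) + ∑ℤ (λ y → sgn (not (w · y)))
    ≡⟨ cong (λ t → ∑ℤ (λ y → sgn (w · y)) + t)
            (trans (sumWith-cong (λ y → sgn-not (w · y))) (∑ℤ-neg (λ y → sgn (w · y)))) ⟩
  ∑ℤ (λ y → sgn (w · y)) - ∑ℤ (λ y → sgn (w · y))
    ≡⟨ ℤₚ.+-inverseʳ (∑ℤ (λ y → sgn (w · y))) ⟩
  0ℤ
    ≡⟨ ℤₚ.*-zeroʳ (+ (2 ^ suc n)) ⟨
  + (2 ^ suc n) * 0ℤ ∎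

∑-δ𝟎 : ∀ {n} (f : Vec Bool n → ℤ) (x : Vec Bool n) → ∑ℤ (λ z → f z * δ𝟎 (z ⊕ x)) ≡ f x
∑-δ𝟎 f []          = ℤₚ.*-identityʳ (f [])
∑-δ𝟎 f (false ∷ x) =
  trans (cong₂ _+_ (∑-δ𝟎 (f ∘ (false ∷_)) x) (∑ℤ-*-zero (f ∘ (true ∷_)))) (ℤₚ.+-identityʳ _)
∑-δ𝟎 f (true ∷ x)  =
  trans (cong₂ _+_ (∑ℤ-*-zero (f ∘ (false ∷_))) (∑-δ𝟎 (f ∘ (true ∷_)) x)) (ℤₚ.+-identityˡ _)

fourier-inversion : ∀ {n} (f : Vec Bool n → ℤ) (x : Vec Bool n) →
                    ∑ℤ (λ y → fourier f y * sgn (x · y)) ≡ + (2 ^ n) * f x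
fourier-inversion {n} f x = begin
  ∑ℤ (λ y → fourier f y * sgn (x · y))
    ≡⟨ sumWith-cong expand ⟩
  ∑ℤ (λ y → ∑ℤ (λ z → f z * sgn ((z ⊕ x) · y)))
    ≡⟨ sumWith-swap ℤₚ.+-isCommutativeSemigroup (λ y z → f z * sgn ((z ⊕ x) · y)) ⟩
  ∑ℤ (λ z → ∑ℤ (λ y → f z * sgn ((z ⊕ x) · y)))
    ≡⟨ sumWith-cong orthogonality ⟩
  ∑ℤ (λ z → f z * (+ (2 ^ n) * δ𝟎 (z ⊕ x)))
    ≡⟨ sumWith-cong (λ z → x∙yz≈y∙xz (f z) (+ (2 ^ n)) (δ𝟎 (z ⊕ x))) ⟩
  ∑ℤ (λ z → + (2 ^ n) * (f z * δ𝟎 (z ⊕ x)))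
    ≡⟨ ∑ℤ-*ˡ (+ (2 ^ n)) (λ z → f z * δ𝟎 (z ⊕ x)) ⟩
  + (2 ^ n) * ∑ℤ (λ z → f z * δ𝟎 (z ⊕ x))
    ≡⟨ cong (+ (2 ^ n) *_) (∑-δ𝟎 f x) ⟩
  + (2 ^ n) * f x ∎
  where
  open CommutativeSemigroupProperties ℤₚ.*-commutativeSemigroup using (x∙yz≈y∙xz)
  expand : ∀ y → fourier f y * sgn (x · y) ≡ ∑ℤ (λ z → f z * sgn ((z ⊕ x) · y))
  expand y = trans (sym (∑ℤ-*ʳ (λ z → f z * sgn (z · y)) (sgn (x · y)))) (sumWith-cong regroup)
    where
    regroup : ∀ z → f z * sgn (z · y) * sgn (x · y) ≡ f z * sgn ((z ⊕ x) · y)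
    regroup z = trans (ℤₚ.*-assoc (f z) _ _) (cong (f z *_) (sym (sgn-·-⊕ z x y)))
  orthogonality : ∀ z → ∑ℤ (λ y → f z * sgn ((z ⊕ x) · y)) ≡ f z * (+ (2 ^ n) * δ𝟎 (z ⊕ x))
  orthogonality z = trans (∑ℤ-*ˡ (f z) (λ y → sgn ((z ⊕ x) · y))) (cong (f z *_) (∑-sgn (z ⊕ x)))

-- Balancing and fixing vectors

charSum≡fourier : ∀ {n} (m : Multiset n) y → charSum m y ≡ fourier (λ x → + m x) y
charSum≡fourier {n} m y = foldr-allVecs ℤₚ.+-0-isMonoid n _

total≡∑ℕ : ∀ {n} (m : Multiset n) → total m ≡ ∑ℕ m
total≡∑ℕ {n} m = foldr-allVecs ℕₚ.+-0-isMonoid n m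

charSum-uniform : ∀ {n} (m : Multiset n) {y} b → (∀ x → Support m x → x · y ≡ b) →
                  charSum m y ≡ sgn b * + total m
charSum-uniform m {y} b uniform = begin
  charSum m y                    ≡⟨ charSum≡fourier m y ⟩
  ∑ℤ (λ x → + m x * sgn (x · y)) ≡⟨ sumWith-cong (λ x → on-support (m x) (cong sgn ∘ uniform x)) ⟩
  ∑ℤ (λ x → sgn b * + m x)       ≡⟨ ∑ℤ-*ˡ (sgn b) (λ x → + m x) ⟩
  sgn b * ∑ℤ (λ x → + m x)       ≡⟨ cong (sgn b *_) (trans (∑ℤ-pos m) (cong +_ (sym (total≡∑ℕ m)))) ⟩
  sgn b * + total m              ∎
  where
  on-support : ∀ k {s} → (0 < k → s ≡ sgn b) → + k * s ≡ sgn b * + k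
  on-support zero    _   = sym (ℤₚ.*-zeroʳ (sgn b))
  on-support (suc k) s≡b = trans (cong (+ suc k *_) (s≡b (s≤s z≤n))) (ℤₚ.*-comm (+ suc k) (sgn b))

∣sgn*∣ : ∀ b k → ∣ sgn b * + k ∣ ≡ k
∣sgn*∣ false k = trans (ℤₚ.abs-* (sgn false) (+ k)) (ℕₚ.*-identityˡ k)
∣sgn*∣ true  k = trans (ℤₚ.abs-* (sgn true) (+ k)) (ℕₚ.*-identityˡ k)

uniform⇒fixes : ∀ {n} (m : Multiset n) {y} b → (∀ x → Support m x → x · y ≡ b) → Fixes m y
uniform⇒fixes m b uniform = trans (cong ∣_∣ (charSum-uniform m b uniform)) (∣sgn*∣ b (total m))

restrict : ∀ {n} → Multiset n → (Vec Bool n → Bool) → Multiset n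
restrict m p x = if p x then m x else 0

restrict-support : ∀ {n} (m : Multiset n) (p : Vec Bool n → Bool) →
                   ∑ℕ (restrict m p) ≡ 0 → ∀ x → Support m x → p x ≡ false
restrict-support m p ∑≡0 x x∈S with p x in px
... | false = refl
... | true  = contradiction (subst (m x ≤_) ∑≡0 mx≤∑) (ℕₚ.<⇒≱ x∈S)
  where
  mx≤∑ : m x ≤ ∑ℕ (restrict m p)
  mx≤∑ = subst (λ b → (if b then m x else 0) ≤ ∑ℕ (restrict m p)) px (term≤∑ℕ (restrict m p) x)

∣p-q∣≡p+q⇒ : ∀ p q → ∣ + p - + q ∣ ≡ p ℕ.+ q → p ≡ 0 ⊎ q ≡ 0
∣p-q∣≡p+q⇒ zero    q       _ = inj₁ refl
∣p-q∣≡p+q⇒ (suc p) zero    _ = inj₂ refl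
∣p-q∣≡p+q⇒ (suc p) (suc q) e =
  contradiction (subst (ℕ._≤ p ℕ.+ q) (trans (cong ∣_∣ shift) e) (ℤₚ.∣i-j∣≤∣i∣+∣j∣ (+ p) (+ q)))
                (ℕₚ.<⇒≱ (ℕₚ.+-mono-< (ℕₚ.n<1+n p) (ℕₚ.n<1+n q)))
  where
  shift : + p - + q ≡ + suc p - + suc q
  shift = trans (ℤₚ.m-n≡m⊖n p q)
                (sym (trans (ℤₚ.m-n≡m⊖n (suc p) (suc q)) (ℤₚ.[1+m]⊖[1+n]≡m⊖n p q)))

module _ {n} (m : Multiset n) (y : Vec Bool n) where

  private
    P N : Multiset n
    P = restrict m (not ∘ (_· y))
    N = restrict m (_· y)

  charSum-split : charSum m y ≡ + ∑ℕ P - + ∑ℕ N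
  charSum-split = begin
    charSum m y                            ≡⟨ charSum≡fourier m y ⟩
    ∑ℤ (λ x → + m x * sgn (x · y))         ≡⟨ sumWith-cong (λ x → sign-split (x · y) (m x)) ⟩
    ∑ℤ (λ x → + P x - + N x)               ≡⟨ sumWith-distrib ℤₚ.+-isCommutativeSemigroup
                                                (λ x → + P x) (λ x → - + N x) ⟩
    ∑ℤ (λ x → + P x) + ∑ℤ (λ x → - + N x) ≡⟨ cong (λ t → ∑ℤ (λ x → + P x) + t) (∑ℤ-neg (λ x → + N x)) ⟩
    ∑ℤ (λ x → + P x) - ∑ℤ (λ x → + N x)   ≡⟨ cong₂ _-_ (∑ℤ-pos P) (∑ℤ-pos N) ⟩
    + ∑ℕ P - + ∑ℕ N                        ∎
    where
    sign-split : ∀ b k → + k * sgn b ≡ + (if not b then k else 0) - + (if b then k else 0)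
    sign-split false k = trans (ℤₚ.*-identityʳ (+ k)) (sym (ℤₚ.+-identityʳ (+ k)))
    sign-split true  k =
      trans (ℤₚ.*-comm (+ k) -1ℤ) (trans (ℤₚ.-1*i≡-i (+ k)) (sym (ℤₚ.+-identityˡ (- + k))))

  total-split : total m ≡ ∑ℕ P ℕ.+ ∑ℕ N
  total-split = begin
    total m                ≡⟨ total≡∑ℕ m ⟩
    ∑ℕ m                   ≡⟨ sumWith-cong (λ x → count-split (x · y) (m x)) ⟨
    ∑ℕ (λ x → P x ℕ.+ N x) ≡⟨ sumWith-distrib ℕₚ.+-isCommutativeSemigroup P N ⟩
    ∑ℕ P ℕ.+ ∑ℕ N          ∎
    where
    count-split : ∀ b k → (if not b then k else 0) ℕ.+ (if b then k else 0) ≡ k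
    count-split false k = ℕₚ.+-identityʳ k
    count-split true  k = refl

-- ∣ P - N ∣ = P + N forces one of the two cosets x · y ≡ b to carry no mass.
fixes⇒uniform : ∀ {n} (m : Multiset n) {y} → Fixes m y → ∃ λ b → ∀ x → Support m x → x · y ≡ b
fixes⇒uniform m {y} fixes
  with ∣p-q∣≡p+q⇒ _ _ (trans (cong ∣_∣ (sym (charSum-split m y))) (trans fixes (total-split m y)))
... | inj₁ P≡0 = true , λ x x∈S →
  trans (sym (not-involutive _)) (cong not (restrict-support m (not ∘ (_· y)) P≡0 x x∈S))
... | inj₂ N≡0 = false , restrict-support m (_· y) N≡0

fixes⇒·-constant : ∀ {n} (m : Multiset n) {y x x′} → Fixes m y →
                   Support m x → Support m x′ → x · y ≡ x′ · y
fixes⇒·-constant m fixes x∈S x′∈S =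
  let _ , uniform = fixes⇒uniform m fixes in trans (uniform _ x∈S) (sym (uniform _ x′∈S))

-- A period v with v · y ≡ true pairs each x with x ⊕ v of opposite sign.
period-balances : ∀ {n} (m : Multiset n) {v y} → (∀ x → m (x ⊕ v) ≡ m x) → v · y ≡ true →
                  Balances m y
period-balances m {v} {y} period v·y≡true = i≡-i⇒i≡0 (begin
  charSum m y                                ≡⟨ charSum≡fourier m y ⟩
  ∑ℤ (λ x → + m x * sgn (x · y))             ≡⟨ sumWith-translate ℤₚ.+-isCommutativeSemigroup _ v ⟨
  ∑ℤ (λ x → + m (x ⊕ v) * sgn ((x ⊕ v) · y)) ≡⟨ sumWith-cong sign-flips ⟩
  ∑ℤ (λ x → - (+ m x * sgn (x · y)))         ≡⟨ ∑ℤ-neg (λ x → + m x * sgn (x · y)) ⟩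
  - ∑ℤ (λ x → + m x * sgn (x · y))           ≡⟨ cong -_ (charSum≡fourier m y) ⟨
  - charSum m y                              ∎)
  where
  i≡-i⇒i≡0 : ∀ {i} → i ≡ - i → i ≡ 0ℤ
  i≡-i⇒i≡0 {+ zero} _ = refl
  i≡-i⇒i≡0 {+[1+ _ ]} ()
  i≡-i⇒i≡0 { -[1+ _ ]} ()
  negate : ∀ (a s : ℤ) → a * (s * - (+ 1)) ≡ - (a * s)
  negate = solve-∀
  sign-flips : ∀ x → + m (x ⊕ v) * sgn ((x ⊕ v) · y) ≡ - (+ m x * sgn (x · y))
  sign-flips x = begin
    + m (x ⊕ v) * sgn ((x ⊕ v) · y)     ≡⟨ cong₂ _*_ (cong +_ (period x)) (sgn-·-⊕ x v y) ⟩
    + m x * (sgn (x · y) * sgn (v · y)) ≡⟨ cong (λ b → + m x * (sgn (x · y) * sgn b)) v·y≡true ⟩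
    + m x * (sgn (x · y) * - (+ 1))     ≡⟨ negate (+ m x) (sgn (x · y)) ⟩
    - (+ m x * sgn (x · y))             ∎

affine-period : ∀ {n} {m : Multiset n} {a : Vec Bool n} {V : Vec Bool n → Set} →
  IsLinearSubspace V → (∀ x → (Support m x → V (x ⊕ a)) × (V (x ⊕ a) → Support m x)) →
  ConstantOn m (Support m) → ∀ {v} → V v → ∀ x → m (x ⊕ v) ≡ m x
affine-period {m = m} V-linear coset constant {v} v∈V x with 0 <? m x
... | yes x∈S = constant _ _ (affine-translate V-linear coset v∈V x∈S) x∈S
... | no  x∉S = trans (≮0⇒≡0 x⊕v∉S) (sym (≮0⇒≡0 x∉S))
  where
  ≮0⇒≡0 : ∀ {k} → ¬ 0 < k → k ≡ 0
  ≮0⇒≡0 k≮0 = ℕₚ.n≤0⇒n≡0 (ℕₚ.≮⇒≥ k≮0)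
  x⊕v∉S : ¬ Support m (x ⊕ v)
  x⊕v∉S s = x∉S (subst (Support m) (⊕-cancelʳ x v) (affine-translate V-linear coset v∈V s))

affine⇒fullyBalanced : ∀ {n} (m : Multiset n) →
  IsAffineSubspace (Support m) → ConstantOn m (Support m) → FullyBalanced m
affine⇒fullyBalanced m (a , V , V-linear , coset) constant y
  with any? (λ x → 0 <? m x ×-dec (x ⊕ a) · y ≟ true)
... | yes (x , x∈S , e) =
  inj₁ (period-balances m (affine-period V-linear coset constant (proj₁ (coset x) x∈S)) e)
... | no ∄x = inj₂ (uniform⇒fixes m (a · y) λ x x∈S →
  xor≡false⇒≡ (trans (sym (·-distribʳ-⊕ x a y)) (¬-not (λ e → ∄x (x , x∈S , e)))))

module _ {n} {m : Multiset n} {x₀ : Vec Bool n} (x₀∈S : Support m x₀) (balanced : FullyBalanced m) where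

  private
    fixing : Vec Bool n → ℕ
    fixing y = [ const 0 , const 1 ] (balanced y)

    V : Vec Bool n → Set
    V = Annihilator (Fixes m)

  charSum-fullyBalanced : ∀ y → charSum m y ≡ + fixing y * (sgn (x₀ · y) * + total m)
  charSum-fullyBalanced y with balanced y
  ... | inj₁ balances = balances
  ... | inj₂ fixes    =
    trans (charSum-uniform m (x₀ · y) (λ x x∈S → fixes⇒·-constant m fixes x∈S x₀∈S))
          (sym (ℤₚ.*-identityˡ _))

  total>0 : 0 < total m
  total>0 = ℕₚ.<-≤-trans x₀∈S (subst (m x₀ ≤_) (sym (total≡∑ℕ m)) (term≤∑ℕ m x₀))

  ∑fixing>0 : 0 < ∑ℕ fixing
  ∑fixing>0 = subst (_≤ ∑ℕ fixing) 𝟎-fixes (term≤∑ℕ fixing 𝟎)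
    where
    𝟎-fixes : fixing 𝟎 ≡ 1
    𝟎-fixes with balanced 𝟎
    ... | inj₂ _        = refl
    ... | inj₁ balances = contradiction (ℤₚ.+-injective (begin
      + total m           ≡⟨ ℤₚ.*-identityˡ _ ⟨
      + 1 * + total m     ≡⟨ charSum-uniform m false (λ x _ → ·-zeroʳ x) ⟨
      charSum m 𝟎         ≡⟨ balances ⟩
      + 0                 ∎)) (ℕₚ.>⇒≢ total>0)

  support⇒annihilator : ∀ {x} → Support m x → V (x ⊕ x₀)
  support⇒annihilator {x} x∈S y fixes =
    trans (·-distribʳ-⊕ x x₀ y)
          (trans (cong (_xor (x₀ · y)) (fixes⇒·-constant m fixes x∈S x₀∈S)) (xor-same (x₀ · y)))

  2ⁿ*m≡total*∑fixing : ∀ {x} → V (x ⊕ x₀) → 2 ^ n ℕ.* m x ≡ total m ℕ.* ∑ℕ fixing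
  2ⁿ*m≡total*∑fixing {x} x⊕x₀∈V = ℤₚ.+-injective (begin
    + (2 ^ n ℕ.* m x)
      ≡⟨ ℤₚ.pos-* (2 ^ n) (m x) ⟩
    + (2 ^ n) * + m x
      ≡⟨ fourier-inversion (λ x → + m x) x ⟨
    ∑ℤ (λ y → fourier (λ x → + m x) y * sgn (x · y))
      ≡⟨ sumWith-cong (λ y → cong (_* sgn (x · y))
                                  (trans (sym (charSum≡fourier m y)) (charSum-fullyBalanced y))) ⟩
    ∑ℤ (λ y → + fixing y * (sgn (x₀ · y) * T) * sgn (x · y))
      ≡⟨ sumWith-cong regroup ⟩
    ∑ℤ (λ y → T * (+ fixing y * sgn ((x ⊕ x₀) · y)))
      ≡⟨ ∑ℤ-*ˡ T (λ y → + fixing y * sgn ((x ⊕ x₀) · y)) ⟩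
    T * ∑ℤ (λ y → + fixing y * sgn ((x ⊕ x₀) · y))
      ≡⟨ cong (T *_) (trans (sumWith-cong orthogonal) (∑ℤ-pos fixing)) ⟩
    T * + ∑ℕ fixing
      ≡⟨ ℤₚ.pos-* (total m) (∑ℕ fixing) ⟨
    + (total m ℕ.* ∑ℕ fixing) ∎)
    where
    T = + total m
    reorder : ∀ (i s₀ t s : ℤ) → i * (s₀ * t) * s ≡ t * (i * (s * s₀))
    reorder = solve-∀
    regroup : ∀ y → + fixing y * (sgn (x₀ · y) * T) * sgn (x · y) ≡
                    T * (+ fixing y * sgn ((x ⊕ x₀) · y))
    regroup y = trans (reorder (+ fixing y) (sgn (x₀ · y)) T (sgn (x · y)))
                      (cong (λ s → T * (+ fixing y * s)) (sym (sgn-·-⊕ x x₀ y)))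
    orthogonal : ∀ y → + fixing y * sgn ((x ⊕ x₀) · y) ≡ + fixing y
    orthogonal y with balanced y
    ... | inj₁ _     = refl
    ... | inj₂ fixes rewrite x⊕x₀∈V y fixes = refl

  annihilator⇒support : ∀ {x} → V (x ⊕ x₀) → Support m x
  annihilator⇒support {x} x⊕x₀∈V = ℕₚ.n≢0⇒n>0 λ mx≡0 →
    [ ℕₚ.>⇒≢ total>0 , ℕₚ.>⇒≢ ∑fixing>0 ]
      (ℕₚ.m*n≡0⇒m≡0∨n≡0 (total m) (begin
        total m ℕ.* ∑ℕ fixing ≡⟨ 2ⁿ*m≡total*∑fixing x⊕x₀∈V ⟨
        2 ^ n ℕ.* m x         ≡⟨ cong (2 ^ n ℕ.*_) mx≡0 ⟩
        2 ^ n ℕ.* 0           ≡⟨ ℕₚ.*-zeroʳ (2 ^ n) ⟩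
        0                     ∎))

  fullyBalanced⇒constant : ConstantOn m (Support m)
  fullyBalanced⇒constant x x′ x∈S x′∈S = ℕₚ.*-cancelˡ-≡ (m x) (m x′) (2 ^ n) {{ℕₚ.m^n≢0 2 n}}
    (trans (2ⁿ*m≡total*∑fixing (support⇒annihilator x∈S))
           (sym (2ⁿ*m≡total*∑fixing (support⇒annihilator x′∈S))))

  fullyBalanced⇒affine : IsAffineSubspace (Support m)
  fullyBalanced⇒affine =
    x₀ , V , annihilator-isLinearSubspace (Fixes m) , λ x → support⇒annihilator , annihilator⇒support

theorem6 : (n : ℕ) (m : Multiset n) →
    ∃ (λ (x : Vec Bool n) → Support m x) →
    FullyBalanced m ⇔ (IsAffineSubspace (Support m) × ConstantOn m (Support m))
theorem6 n m (x₀ , x₀∈S) = mk⇔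
  (λ balanced → fullyBalanced⇒affine x₀∈S balanced , fullyBalanced⇒constant x₀∈S balanced)
  (uncurry (affine⇒fullyBalanced m))
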